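{- Let $\lambda$ be the POP of size 4 with relations $1>2$ and $1>4$, and let $I_k=12\cdots k$. For $n\geq 4$, there are exactly $n-3$ permutations of length $n$ avoiding $\lambda$ that are inflations of $2413$, namely $2413[I_\ell, I_{n-\ell-2}, 1, 1]$ for $\ell\in[n-3]$.
   Context: An $n$-permutation $\pi$ contains $\lambda$ iff there are $i_1<i_2<i_3<i_4$ with $\pi_{i_1}>\pi_{i_2}$ and $\pi_{i_1}>\pi_{i_4}$. For a $k$-permutation $\sigma$ and permutations $\alpha^{(1)},\dots,\alpha^{(k)}$, the inflation $\sigma[\alpha^{(1)},\dots,\alpha^{(k)}]$ is the permutation obtained by replacing each entry $\sigma_\ell$ by a consecutive block of positions, order-isomorphic to $\alpha^{(\ell)}$, whose values form an interval, with the blocks ordered relative to each other as the entries of $\sigma$ are. -}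

module Defs where

open import Data.Nat using (ℕ; zero; suc; _+_; _∸_; _<_; _≤_; _<ᵇ_)
open import Data.Bool using (if_then_else_)
open import Data.List using (List; []; _∷_; map; upTo; concat; zipWith; length)
open import Data.Nat.ListAction using (sum)
open import Data.List.Relation.Binary.Permutation.Propositional using (_↭_)
open import Data.List.Relation.Binary.Sublist.Propositional using (_⊆_)
open import Data.Product using (Σ; ∃; _×_)

-- Permutations are written in one-line notation as lists of values 1..n.

I : ℕ → List ℕ
I k = map suc (upTo k)

IsPerm : ℕ → List ℕ → Set
IsPerm n π = π ↭ I n

IsPermutation : List ℕ → Set
IsPermutation π = IsPerm (length π) π

-- π contains the POP λ (size 4, relations 1>2 and 1>4): there are
-- positions i1<i2<i3<i4 with π_{i1} > π_{i2} and π_{i1} > π_{i4},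
-- i.e. a length-4 subsequence a b c d of π with a > b and a > d.
ContainsLam : List ℕ → Set
ContainsLam π = Σ ℕ λ a → Σ ℕ λ b → Σ ℕ λ c → Σ ℕ λ d →
  ((a ∷ b ∷ c ∷ d ∷ []) ⊆ π) × (b < a) × (d < a)

AvoidsLam : List ℕ → Set
AvoidsLam π = ContainsLam π → Data.Empty.⊥
  where import Data.Empty

-- Inflation σ[α(1),...,α(k)]: block ℓ is α(ℓ) shifted by the total size
-- of the blocks α(j) with σ_j < σ_ℓ; blocks are concatenated in order.
inflate : List ℕ → List (List ℕ) → List ℕ
inflate σ αs = concat (zipWith (λ s α → map (offset s +_) α) σ αs)
  where
  offset : ℕ → ℕ
  offset s = sum (zipWith (λ t β → if t <ᵇ s then length β else 0) σ αs)

p2413 : List ℕ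
p2413 = 2 ∷ 4 ∷ 1 ∷ 3 ∷ []

IsInflationOf2413 : List ℕ → Set
IsInflationOf2413 π = Σ (List ℕ) λ α₁ → Σ (List ℕ) λ α₂ → Σ (List ℕ) λ α₃ → Σ (List ℕ) λ α₄ →
  (IsPermutation α₁ × 1 ≤ length α₁) ×
  (IsPermutation α₂ × 1 ≤ length α₂) ×
  (IsPermutation α₃ × 1 ≤ length α₃) ×
  (IsPermutation α₄ × 1 ≤ length α₄) ×
  (π ≡ inflate p2413 (α₁ ∷ α₂ ∷ α₃ ∷ α₄ ∷ []))
  where open import Relation.Binary.PropositionalEquality using (_≡_)

family : ℕ → ℕ → List ℕ
family n ℓ = inflate p2413 (I ℓ ∷ I (n ∸ ℓ ∸ 2) ∷ I 1 ∷ I 1 ∷ [])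

familyList : ℕ → List (List ℕ)
familyList n = map (family n) (map suc (upTo (n ∸ 3)))

-- In 2413[α₁, α₂, α₃, α₄] every entry of the α₂-block exceeds every entry of the
-- α₃- and α₄-blocks that follow it, so an α₂-entry followed by three of them is an
-- occurrence of λ; hence |α₃| + |α₄| ≤ 2 and α₃ = α₄ = 1.  A descent of α₁ followed
-- by an α₂-entry and the final 1, or a descent of α₂ followed by the last two
-- entries, is again an occurrence, so α₁ and α₂ are increasing.  Conversely
-- 2413[I_ℓ, I_m, 1, 1] is an increasing word followed by two entries, and the first
-- two entries of an occurrence of λ would have to lie in the increasing word.

module Submission where

open import Defs
open import Data.Nat using (ℕ; _≤_; _∸_)
open import Data.List using (List; length)
open import Data.List.Membership.Propositional using (_∈_)
open import Data.List.Relation.Unary.Unique.Propositional using (Unique)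
open import Data.Product using (_×_)
open import Function.Bundles using (_⇔_)
open import Relation.Binary.PropositionalEquality using (_≡_)

open import Data.Nat using (zero; suc; _+_; _<_; z≤n; s≤s; s≤s⁻¹)
open import Data.Nat.Properties
open import Data.Nat.Tactic.RingSolver using (solve-∀)
open import Data.List using ([]; _∷_; _++_; map; upTo)
open import Data.List.Properties using (length-map; length-++; length-upTo; ++-assoc; map-++; map-∘; map-cong; map-id; ++-identityʳ; upTo-∷ʳ; ∷ʳ-injectiveʳ)
open import Data.List.Relation.Binary.Sublist.Propositional using (_⊆_; _∷_; _∷ʳ_; minimum; ⊆-refl; ⊆-trans)
import Data.List.Relation.Binary.Sublist.Propositional.Properties as Sublist
open import Data.List.Relation.Unary.All as All using (All; []; _∷_)
import Data.List.Relation.Unary.All.Properties as All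
open import Data.List.Relation.Unary.AllPairs as AllPairs using (AllPairs; []; _∷_)
import Data.List.Relation.Unary.AllPairs.Properties as AllPairs
open import Data.List.Relation.Unary.Linked as Linked using (Linked; []; [-]; _∷_)
import Data.List.Relation.Unary.Linked.Properties as Linked
import Data.List.Relation.Unary.Sorted.TotalOrder.Properties as Sorted
open import Data.List.Relation.Binary.Pointwise using (Pointwise-≡⇒≡)
open import Data.List.Relation.Binary.Permutation.Propositional using (_↭_; ↭-sym; ↭-reflexive; ↭⇒↭ₛ; module PermutationReasoning)
open import Data.List.Relation.Binary.Permutation.Propositional.Properties using (All-resp-↭; ↭-length; ↭-singleton-inv; shift; ++-comm; ++⁺ˡ)
open import Data.List.Membership.Propositional.Properties using (∈-map⁺; ∈-map⁻; ∈-upTo⁺; ∈-upTo⁻)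
import Data.List.Relation.Unary.Unique.Propositional.Properties as Unique
open import Data.Product using (Σ; ∃₂; _,_; proj₁)
open import Data.Empty using (⊥; ⊥-elim)
open import Function.Bundles using (mk⇔)
open import Relation.Binary.PropositionalEquality using (refl; sym; trans; cong; cong₂; subst; module ≡-Reasoning)

Positive≤ : ℕ → ℕ → Set
Positive≤ k x = 1 ≤ x × x ≤ k

length-I : ∀ k → length (I k) ≡ k
length-I k = trans (length-map suc (upTo k)) (length-upTo k)

I-bounds : ∀ k → All (Positive≤ k) (I k)
I-bounds k = All.map⁺ (All.map (λ i<k → s≤s z≤n , i<k) (All.all-upTo k))

↭I⇒bounds : ∀ {π k} → π ↭ I k → All (Positive≤ k) π
↭I⇒bounds π↭I = All-resp-↭ (↭-sym π↭I) (I-bounds _)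

↭I⇒positive : ∀ {π k} → π ↭ I k → All (1 ≤_) π
↭I⇒positive π↭I = All.map proj₁ (↭I⇒bounds π↭I)

I-increasing : ∀ k → AllPairs _≤_ (I k)
I-increasing k = AllPairs.map⁺ (AllPairs.applyUpTo⁺₁ (λ x → x) k (λ i<j _ → s≤s (<⇒≤ i<j)))

increasing-↭I⇒≡I : ∀ {π k} → Linked _≤_ π → π ↭ I k → π ≡ I k
increasing-↭I⇒≡I {k = k} π↗ π↭I = Pointwise-≡⇒≡
  (Sorted.↗↭↗⇒≋ ≤-totalOrder π↗ (Linked.AllPairs⇒Linked (I-increasing k)) (↭⇒↭ₛ π↭I))

I-isPermutation : ∀ k → IsPermutation (I k)
I-isPermutation k = ↭-reflexive (cong I (sym (length-I k)))

permutation-of-length-1 : ∀ {α} → IsPermutation α → length α ≡ 1 → α ≡ 1 ∷ []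
permutation-of-length-1 {α} α↭I |α|≡1 = ↭-singleton-inv (subst (λ k → α ↭ I k) |α|≡1 α↭I)

I-suc : ∀ k → I (suc k) ≡ I k ++ suc k ∷ []
I-suc k = trans (cong (map suc) (sym (upTo-∷ʳ k))) (map-++ suc (upTo k) (k ∷ []))

I-+ : ∀ a b → I (a + b) ≡ I a ++ map (a +_) (I b)
I-+ a zero = trans (cong I (+-identityʳ a)) (sym (++-identityʳ (I a)))
I-+ a (suc b) = begin
  I (a + suc b)                               ≡⟨ cong I (+-suc a b) ⟩
  I (suc (a + b))                             ≡⟨ I-suc (a + b) ⟩
  I (a + b) ++ suc (a + b) ∷ []               ≡⟨ cong₂ (λ xs x → xs ++ x ∷ []) (I-+ a b) (sym (+-suc a b)) ⟩
  (I a ++ map (a +_) (I b)) ++ a + suc b ∷ []  ≡⟨ ++-assoc (I a) _ _ ⟩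
  I a ++ (map (a +_) (I b) ++ a + suc b ∷ [])  ≡⟨ cong (I a ++_) (sym (map-++ (a +_) (I b) _)) ⟩
  I a ++ map (a +_) (I b ++ suc b ∷ [])        ≡⟨ cong (λ xs → I a ++ map (a +_) xs) (sym (I-suc b)) ⟩
  I a ++ map (a +_) (I (suc b))               ∎
  where open ≡-Reasoning

avoidsLam-⊆ : ∀ {xs ys} → xs ⊆ ys → AvoidsLam ys → AvoidsLam xs
avoidsLam-⊆ xs⊆ys avoid (a , b , c , d , abcd⊆xs , b<a , d<a) =
  avoid (a , b , c , d , ⊆-trans abcd⊆xs xs⊆ys , b<a , d<a)

avoidsLam⇒≤2-smaller-after : ∀ {a zs} → AvoidsLam (a ∷ zs) → All (_< a) zs → length zs ≤ 2
avoidsLam⇒≤2-smaller-after {zs = []}          _ _ = z≤n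
avoidsLam⇒≤2-smaller-after {zs = _ ∷ []}      _ _ = s≤s z≤n
avoidsLam⇒≤2-smaller-after {zs = _ ∷ _ ∷ []}  _ _ = s≤s (s≤s z≤n)
avoidsLam⇒≤2-smaller-after {a} {b ∷ c ∷ d ∷ zs} avoid (b<a ∷ _ ∷ d<a ∷ _) =
  ⊥-elim (avoid (a , b , c , d , refl ∷ refl ∷ refl ∷ refl ∷ minimum zs , b<a , d<a))

noInversion⇒Linked : ∀ {xs} → (∀ {x y} → (x ∷ y ∷ []) ⊆ xs → y < x → ⊥) → Linked _≤_ xs
noInversion⇒Linked {[]}         _     = []
noInversion⇒Linked {x ∷ []}     _     = [-]
noInversion⇒Linked {x ∷ y ∷ xs} noInv =
  ≮⇒≥ (noInv (refl ∷ refl ∷ minimum xs)) ∷ noInversion⇒Linked (λ xy⊆ → noInv (x ∷ʳ xy⊆))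

avoidsLam⇒increasing : ∀ {xs c d} → AvoidsLam (xs ++ c ∷ d ∷ []) → All (d <_) xs → Linked _≤_ xs
avoidsLam⇒increasing {c = c} {d} avoid d<xs = noInversion⇒Linked λ {x} {y} xy⊆ y<x →
  avoid (x , y , c , d , Sublist.++⁺ xy⊆ ⊆-refl , y<x , All.head (Sublist.All-resp-⊆ xy⊆ d<xs))

head∈prefix : ∀ {P : ℕ → Set} {b cs} xs ys → All P xs → (b ∷ cs) ⊆ xs ++ ys →
              length ys ≤ length cs → P b
head∈prefix []       ys _          bcs⊆ys |ys|≤ = ⊥-elim (n≮n _ (≤-trans (Sublist.length-mono-≤ bcs⊆ys) |ys|≤))
head∈prefix (x ∷ xs) ys (_ ∷ Pxs)  (.x ∷ʳ bcs⊆) |ys|≤ = head∈prefix xs ys Pxs bcs⊆ |ys|≤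
head∈prefix (x ∷ xs) ys (Px ∷ _)   (refl ∷ _)   _     = Px

increasing++short⇒≤ : ∀ {a b cs} xs ys → AllPairs _≤_ xs → (a ∷ b ∷ cs) ⊆ xs ++ ys →
                      length ys ≤ length cs → a ≤ b
increasing++short⇒≤ []       ys _           abcs⊆ys |ys|≤ =
  ⊥-elim (n≮n _ (≤-trans (n≤1+n _) (≤-trans (Sublist.length-mono-≤ abcs⊆ys) |ys|≤)))
increasing++short⇒≤ (x ∷ xs) ys (_ ∷ xs↗)   (.x ∷ʳ abcs⊆) |ys|≤ = increasing++short⇒≤ xs ys xs↗ abcs⊆ |ys|≤
increasing++short⇒≤ (x ∷ xs) ys (x≤xs ∷ _) (refl ∷ bcs⊆) |ys|≤ = head∈prefix xs ys x≤xs bcs⊆ |ys|≤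

increasing++pair-avoidsLam : ∀ {xs u v} → AllPairs _≤_ xs → AvoidsLam (xs ++ u ∷ v ∷ [])
increasing++pair-avoidsLam {xs} xs↗ (_ , _ , _ , _ , abcd⊆ , b<a , _) =
  <⇒≱ b<a (increasing++short⇒≤ xs _ xs↗ abcd⊆ ≤-refl)

inflate2413 : List ℕ → List ℕ → List ℕ → List ℕ → List ℕ
inflate2413 α₁ α₂ α₃ α₄ =
  map (length α₃ +_) α₁ ++ map (length α₁ + (length α₃ + length α₄) +_) α₂ ++
  α₃ ++ map (length α₁ + length α₃ +_) α₄

inflate-p2413 : ∀ α₁ α₂ α₃ α₄ → inflate p2413 (α₁ ∷ α₂ ∷ α₃ ∷ α₄ ∷ []) ≡ inflate2413 α₁ α₂ α₃ α₄
inflate-p2413 α₁ α₂ α₃ α₄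
  rewrite +-identityʳ (length α₃) | +-identityʳ (length α₄)
        | ++-identityʳ (map (length α₁ + length α₃ +_) α₄)
  = cong (λ β₃ → map (length α₃ +_) α₁ ++ map (length α₁ + (length α₃ + length α₄) +_) α₂ ++
                 β₃ ++ map (length α₁ + length α₃ +_) α₄)
         (map-id α₃)

avoidsLam-inflate2413⇒|α₃|+|α₄|≤2 : ∀ {α₁ α₂ α₃ α₄} → AvoidsLam (inflate2413 α₁ α₂ α₃ α₄) →
  IsPermutation α₂ → 1 ≤ length α₂ → IsPermutation α₃ → IsPermutation α₄ →
  length α₃ + length α₄ ≤ 2
avoidsLam-inflate2413⇒|α₃|+|α₄|≤2 {α₁} {c ∷ α₂} {α₃} {α₄} avoid α₂↭I _ α₃↭I α₄↭I = begin
  length α₃ + length α₄             ≡⟨ sym (cong (length α₃ +_) (length-map (ℓ₁ + ℓ₃ +_) α₄)) ⟩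
  length α₃ + length lowerRight     ≡⟨ sym (length-++ α₃) ⟩
  length (α₃ ++ lowerRight)         ≤⟨ avoidsLam⇒≤2-smaller-after (avoidsLam-⊆ sub avoid) lower ⟩
  2                                 ∎
  where
  open ≤-Reasoning
  ℓ₁ ℓ₃ ℓ₄ top : ℕ
  ℓ₁ = length α₁
  ℓ₃ = length α₃
  ℓ₄ = length α₄
  top = ℓ₁ + (ℓ₃ + ℓ₄)
  lowerRight : List ℕ
  lowerRight = map (ℓ₁ + ℓ₃ +_) α₄
  sub : (top + c ∷ α₃ ++ lowerRight) ⊆ inflate2413 α₁ (c ∷ α₂) α₃ α₄
  sub = Sublist.++⁺ˡ (map (ℓ₃ +_) α₁) (refl ∷ Sublist.++⁺ˡ (map (top +_) α₂) ⊆-refl)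
  below : ∀ {x} → x ≤ top → x < top + c
  below x≤top = ≤-<-trans x≤top (m<m+n top (All.head (↭I⇒positive α₂↭I)))
  lower : All (_< top + c) (α₃ ++ lowerRight)
  lower = All.++⁺
    (All.map (λ (_ , x≤ℓ₃) → below (≤-trans x≤ℓ₃ (≤-trans (m≤m+n ℓ₃ ℓ₄) (m≤n+m _ ℓ₁)))) (↭I⇒bounds α₃↭I))
    (All.map⁺ (All.map (λ (_ , x≤ℓ₄) → below (≤-trans (+-monoʳ-≤ (ℓ₁ + ℓ₃) x≤ℓ₄) (≤-reflexive (+-assoc ℓ₁ ℓ₃ ℓ₄))))
                       (↭I⇒bounds α₄↭I)))

1≤n∧m+n≤2⇒m≤1 : ∀ {m n} → 1 ≤ n → m + n ≤ 2 → m ≤ 1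
1≤n∧m+n≤2⇒m≤1 {m} 1≤n m+n≤2 = +-cancelʳ-≤ 1 m 1 (≤-trans (+-monoʳ-≤ m 1≤n) m+n≤2)

avoidsLam-inflate2413⇒singletons : ∀ {α₁ α₂ α₃ α₄} → AvoidsLam (inflate2413 α₁ α₂ α₃ α₄) →
  IsPermutation α₂ → 1 ≤ length α₂ → IsPermutation α₃ → 1 ≤ length α₃ →
  IsPermutation α₄ → 1 ≤ length α₄ → α₃ ≡ 1 ∷ [] × α₄ ≡ 1 ∷ []
avoidsLam-inflate2413⇒singletons {α₁} {α₂} {α₃} {α₄} avoid α₂↭I 1≤ℓ₂ α₃↭I 1≤ℓ₃ α₄↭I 1≤ℓ₄ =
  permutation-of-length-1 α₃↭I (≤-antisym (1≤n∧m+n≤2⇒m≤1 1≤ℓ₄ short) 1≤ℓ₃) ,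
  permutation-of-length-1 α₄↭I (≤-antisym (1≤n∧m+n≤2⇒m≤1 1≤ℓ₃ (≤-trans (≤-reflexive (+-comm (length α₄) _)) short)) 1≤ℓ₄)
  where
  short : length α₃ + length α₄ ≤ 2
  short = avoidsLam-inflate2413⇒|α₃|+|α₄|≤2 {α₁} {α₂} avoid α₂↭I 1≤ℓ₂ α₃↭I α₄↭I

inflate2413₁₁ : List ℕ → List ℕ → List ℕ
inflate2413₁₁ α β = map suc α ++ map (2 + length α +_) β ++ 1 ∷ 2 + length α ∷ []

inflate2413-singletons : ∀ α β → inflate2413 α β (1 ∷ []) (1 ∷ []) ≡ inflate2413₁₁ α β
inflate2413-singletons α β
  rewrite +-comm (length α) 2 | +-comm (length α + 1) 1 | +-comm (length α) 1 = refl

inflate-p2413-singletons : ∀ α β → inflate p2413 (α ∷ β ∷ I 1 ∷ I 1 ∷ []) ≡ inflate2413₁₁ α β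
inflate-p2413-singletons α β = trans (inflate-p2413 α β (I 1) (I 1)) (inflate2413-singletons α β)

length-inflate2413₁₁ : ∀ α β → length (inflate2413₁₁ α β) ≡ length α + (length β + 2)
length-inflate2413₁₁ α β = begin
  length (inflate2413₁₁ α β)                                       ≡⟨ length-++ (map suc α) ⟩
  length (map suc α) + length (map (2 + length α +_) β ++ _)       ≡⟨ cong₂ _+_ (length-map suc α) (length-++ (map (2 + length α +_) β)) ⟩
  length α + (length (map (2 + length α +_) β) + 2)                ≡⟨ cong (λ k → length α + (k + 2)) (length-map _ β) ⟩
  length α + (length β + 2)                                        ∎
  where open ≡-Reasoning

avoidsLam-inflate2413₁₁⇒left-increasing : ∀ {α β} → AvoidsLam (inflate2413₁₁ α β) →
  All (1 ≤_) α → 1 ≤ length β → Linked _≤_ α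
avoidsLam-inflate2413₁₁⇒left-increasing {α} {c ∷ β} avoid α-positive _ =
  Linked.map s≤s⁻¹ (Linked.map⁻ (avoidsLam⇒increasing (avoidsLam-⊆ sub avoid) (All.map⁺ (All.map s≤s α-positive))))
  where
  sub : map suc α ++ 2 + length α + c ∷ 1 ∷ [] ⊆ inflate2413₁₁ α (c ∷ β)
  sub = Sublist.++⁺ ⊆-refl (refl ∷ Sublist.++⁺ˡ (map (2 + length α +_) β) (refl ∷ minimum _))

avoidsLam-inflate2413₁₁⇒right-increasing : ∀ {α β} → AvoidsLam (inflate2413₁₁ α β) →
  All (1 ≤_) β → Linked _≤_ β
avoidsLam-inflate2413₁₁⇒right-increasing {α} avoid β-positive =
  Linked.map (+-cancelˡ-≤ (2 + length α) _ _) (Linked.map⁻ (avoidsLam⇒increasing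
    (avoidsLam-⊆ (Sublist.++⁺ˡ (map suc α) ⊆-refl) avoid) (All.map⁺ (All.map (m<m+n (2 + length α)) β-positive))))

familyMember : ℕ → ℕ → List ℕ
familyMember ℓ m = inflate p2413 (I ℓ ∷ I m ∷ I 1 ∷ I 1 ∷ [])

familyMember≡ : ∀ ℓ m → familyMember ℓ m ≡ map suc (I ℓ) ++ map (2 + ℓ +_) (I m) ++ 1 ∷ 2 + ℓ ∷ []
familyMember≡ ℓ m = trans (inflate-p2413-singletons (I ℓ) (I m))
  (cong (λ k → map suc (I ℓ) ++ map (2 + k +_) (I m) ++ 1 ∷ 2 + k ∷ []) (length-I ℓ))

I-suc+suc : ∀ ℓ m → I (suc ℓ + suc m) ≡ 1 ∷ map suc (I ℓ) ++ 2 + ℓ ∷ map (2 + ℓ +_) (I m)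
I-suc+suc ℓ m = begin
  I (suc ℓ + suc m)                                          ≡⟨ I-+ (suc ℓ) (suc m) ⟩
  I (suc ℓ) ++ map (suc ℓ +_) (I (suc m))                    ≡⟨ cong₂ _++_ (I-+ 1 ℓ) (cong (map (suc ℓ +_)) (I-+ 1 m)) ⟩
  1 ∷ map suc (I ℓ) ++ suc ℓ + 1 ∷ map (suc ℓ +_) (map suc (I m))
    ≡⟨ cong (λ ys → 1 ∷ map suc (I ℓ) ++ ys) (cong₂ _∷_ (cong suc (+-comm ℓ 1)) shift-map) ⟩
  1 ∷ map suc (I ℓ) ++ 2 + ℓ ∷ map (2 + ℓ +_) (I m)          ∎
  where
  open ≡-Reasoning
  shift-map : map (suc ℓ +_) (map suc (I m)) ≡ map (2 + ℓ +_) (I m)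
  shift-map = trans (sym (map-∘ (I m))) (map-cong (λ y → cong suc (+-suc ℓ y)) (I m))

familyMember-↭I : ∀ ℓ m → IsPerm (ℓ + (m + 2)) (familyMember ℓ m)
familyMember-↭I ℓ m = begin
  familyMember ℓ m                          ≡⟨ familyMember≡ ℓ m ⟩
  X ++ Y ++ 1 ∷ 2 + ℓ ∷ []                  ↭⟨ ++⁺ˡ X (++-comm Y (1 ∷ 2 + ℓ ∷ [])) ⟩
  X ++ 1 ∷ 2 + ℓ ∷ Y                        ↭⟨ shift 1 X (2 + ℓ ∷ Y) ⟩
  1 ∷ X ++ 2 + ℓ ∷ Y                        ≡⟨ sym (I-suc+suc ℓ m) ⟩
  I (suc ℓ + suc m)                         ≡⟨ cong I (size ℓ m) ⟩
  I (ℓ + (m + 2))                           ∎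
  where
  open PermutationReasoning
  X Y : List ℕ
  X = map suc (I ℓ)
  Y = map (2 + ℓ +_) (I m)
  size : ∀ ℓ m → suc ℓ + suc m ≡ ℓ + (m + 2)
  size = solve-∀

familyMember-avoidsLam : ∀ ℓ m → AvoidsLam (familyMember ℓ m)
familyMember-avoidsLam ℓ m =
  subst AvoidsLam (sym (trans (familyMember≡ ℓ m) (sym (++-assoc X Y (1 ∷ 2 + ℓ ∷ [])))))
    (increasing++pair-avoidsLam (AllPairs.++⁺ X↗ Y↗ X≤Y))
  where
  X Y : List ℕ
  X = map suc (I ℓ)
  Y = map (2 + ℓ +_) (I m)
  X↗ : AllPairs _≤_ X
  X↗ = AllPairs.map⁺ (AllPairs.map s≤s (I-increasing ℓ))
  Y↗ : AllPairs _≤_ Y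
  Y↗ = AllPairs.map⁺ (AllPairs.map (+-monoʳ-≤ (2 + ℓ)) (I-increasing m))
  X≤Y : All (λ x → All (x ≤_) Y) X
  X≤Y = All.map⁺ (All.map (λ (_ , i≤ℓ) → All.map⁺ (All.map (λ {j} _ →
    ≤-trans (s≤s i≤ℓ) (≤-trans (n≤1+n (suc ℓ)) (m≤m+n (2 + ℓ) j))) (I-bounds m))) (I-bounds ℓ))

familyMember-isInflation : ∀ {ℓ m} → 1 ≤ ℓ → 1 ≤ m → IsInflationOf2413 (familyMember ℓ m)
familyMember-isInflation {ℓ} {m} 1≤ℓ 1≤m =
  I ℓ , I m , I 1 , I 1 ,
  (I-isPermutation ℓ , subst (1 ≤_) (sym (length-I ℓ)) 1≤ℓ) ,
  (I-isPermutation m , subst (1 ≤_) (sym (length-I m)) 1≤m) ,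
  (I-isPermutation 1 , ≤-refl) , (I-isPermutation 1 , ≤-refl) , refl

familyMember-injective : ∀ {ℓ m ℓ′ m′} → familyMember ℓ m ≡ familyMember ℓ′ m′ → ℓ ≡ ℓ′
familyMember-injective {ℓ} {m} {ℓ′} {m′} eq =
  suc-injective (suc-injective (∷ʳ-injectiveʳ (body ℓ m) (body ℓ′ m′)
    (trans (sym (last-split ℓ m)) (trans eq (last-split ℓ′ m′)))))
  where
  body : ℕ → ℕ → List ℕ
  body ℓ m = map suc (I ℓ) ++ map (2 + ℓ +_) (I m) ++ 1 ∷ []
  last-split : ∀ ℓ m → familyMember ℓ m ≡ body ℓ m ++ 2 + ℓ ∷ []
  last-split ℓ m = trans (familyMember≡ ℓ m) (trans
    (cong (map suc (I ℓ) ++_) (sym (++-assoc (map (2 + ℓ +_) (I m)) (1 ∷ []) (2 + ℓ ∷ []))))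
    (sym (++-assoc (map suc (I ℓ)) _ (2 + ℓ ∷ []))))

ℓ+[m+2]∸ℓ∸2≡m : ∀ ℓ m → ℓ + (m + 2) ∸ ℓ ∸ 2 ≡ m
ℓ+[m+2]∸ℓ∸2≡m ℓ m = trans (cong (_∸ 2) (m+n∸m≡n ℓ (m + 2))) (m+n∸n≡m m 2)

<n∸3⇒n≡ : ∀ {j n} → j < n ∸ 3 → Σ ℕ λ e → n ≡ suc j + (suc e + 2)
<n∸3⇒n≡ {j} {suc (suc (suc n))} j<n = n ∸ suc j , (begin
  3 + n                        ≡⟨ cong (3 +_) (sym (m+[n∸m]≡n j<n)) ⟩
  3 + (suc j + (n ∸ suc j))    ≡⟨ regroup j (n ∸ suc j) ⟩
  suc j + (suc (n ∸ suc j) + 2) ∎)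
  where
  open ≡-Reasoning
  regroup : ∀ j e → 3 + (suc j + e) ≡ suc j + (suc e + 2)
  regroup = solve-∀

∈-familyList⁺ : ∀ {n ℓ m} → 1 ≤ ℓ → 1 ≤ m → n ≡ ℓ + (m + 2) → familyMember ℓ m ∈ familyList n
∈-familyList⁺ {n} {suc j} {m} _ 1≤m refl =
  subst (λ k → familyMember (suc j) k ∈ familyList n) (ℓ+[m+2]∸ℓ∸2≡m (suc j) m)
    (∈-map⁺ (family n) (∈-map⁺ suc (∈-upTo⁺ j<n∸3)))
  where
  j<n∸3 : j < n ∸ 3
  j<n∸3 = subst (j <_) (sym (trans (cong (_∸ 2) (sym (+-assoc j m 2))) (m+n∸n≡m (j + m) 2))) (m<m+n j 1≤m)

∈-familyList⁻ : ∀ {n π} → π ∈ familyList n →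
  ∃₂ λ ℓ m → 1 ≤ ℓ × 1 ≤ m × n ≡ ℓ + (m + 2) × π ≡ familyMember ℓ m
∈-familyList⁻ {n} π∈ with ∈-map⁻ (family n) π∈
... | _ , ℓ∈ , refl with ∈-map⁻ suc ℓ∈
... | j , j∈ , refl with e , n≡ ← <n∸3⇒n≡ (∈-upTo⁻ j∈) =
  suc j , suc e , s≤s z≤n , s≤s z≤n , n≡ ,
  cong (familyMember (suc j)) (trans (cong (λ k → k ∸ suc j ∸ 2) n≡) (ℓ+[m+2]∸ℓ∸2≡m (suc j) (suc e)))

familyList-unique : ∀ n → Unique (familyList n)
familyList-unique n = Unique.map⁺ familyMember-injective (Unique.map⁺ suc-injective (Unique.upTo⁺ (n ∸ 3)))

length-familyList : ∀ n → length (familyList n) ≡ n ∸ 3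
length-familyList n = trans (length-map (family n) (map suc (upTo (n ∸ 3))))
  (trans (length-map suc (upTo (n ∸ 3))) (length-upTo (n ∸ 3)))

familyList-sound : ∀ {n π} → π ∈ familyList n → IsPerm n π × AvoidsLam π × IsInflationOf2413 π
familyList-sound π∈ with ℓ , m , 1≤ℓ , 1≤m , refl , refl ← ∈-familyList⁻ π∈ =
  familyMember-↭I ℓ m , familyMember-avoidsLam ℓ m , familyMember-isInflation 1≤ℓ 1≤m

familyList-complete : ∀ {n π} → IsPerm n π → AvoidsLam π → IsInflationOf2413 π → π ∈ familyList n
familyList-complete {n} π↭I avoid
  (α₁ , α₂ , α₃ , α₄ , (α₁↭I , 1≤ℓ₁) , (α₂↭I , 1≤ℓ₂) , (α₃↭I , 1≤ℓ₃) , (α₄↭I , 1≤ℓ₄) , refl)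
  with refl , refl ← avoidsLam-inflate2413⇒singletons {α₁} {α₂}
                       (subst AvoidsLam (inflate-p2413 α₁ α₂ α₃ α₄) avoid) α₂↭I 1≤ℓ₂ α₃↭I 1≤ℓ₃ α₄↭I 1≤ℓ₄
  = subst (_∈ familyList n) (sym (cong₂ (λ α β → inflate p2413 (α ∷ β ∷ I 1 ∷ I 1 ∷ [])) α₁≡I α₂≡I))
      (∈-familyList⁺ 1≤ℓ₁ 1≤ℓ₂ n≡)
  where
  avoid₁₁ : AvoidsLam (inflate2413₁₁ α₁ α₂)
  avoid₁₁ = subst AvoidsLam (inflate-p2413-singletons α₁ α₂) avoid
  α₁≡I : α₁ ≡ I (length α₁)
  α₁≡I = increasing-↭I⇒≡I (avoidsLam-inflate2413₁₁⇒left-increasing avoid₁₁ (↭I⇒positive α₁↭I) 1≤ℓ₂) α₁↭I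
  α₂≡I : α₂ ≡ I (length α₂)
  α₂≡I = increasing-↭I⇒≡I (avoidsLam-inflate2413₁₁⇒right-increasing {α₁} avoid₁₁ (↭I⇒positive α₂↭I)) α₂↭I
  n≡ : n ≡ length α₁ + (length α₂ + 2)
  n≡ = begin
    n                                                 ≡⟨ sym (length-I n) ⟩
    length (I n)                                      ≡⟨ sym (↭-length π↭I) ⟩
    length (inflate p2413 (α₁ ∷ α₂ ∷ I 1 ∷ I 1 ∷ [])) ≡⟨ cong length (inflate-p2413-singletons α₁ α₂) ⟩
    length (inflate2413₁₁ α₁ α₂)                      ≡⟨ length-inflate2413₁₁ α₁ α₂ ⟩
    length α₁ + (length α₂ + 2)                       ∎
    where open ≡-Reasoning

mainTheorem10 : (n : ℕ) → 4 ≤ n →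
    Unique (familyList n) × length (familyList n) ≡ n ∸ 3 ×
    ((π : List ℕ) → (IsPerm n π × AvoidsLam π × IsInflationOf2413 π) ⇔ (π ∈ familyList n))
mainTheorem10 n _ =
  familyList-unique n , length-familyList n ,
  λ π → mk⇔ (λ (π↭I , avoid , inflation) → familyList-complete π↭I avoid inflation) familyList-sound
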